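{- Let $G=(V,E)$ be a graph on $n\ge 2$ vertices whose true order $x_1\prec\cdots\prec x_n$ forms a Hamiltonian path in $G$ (i.e., $(x_i,x_{i+1})\in E$ for all $i$), where a query of an edge reveals which endpoint precedes the other. Consider the following procedure: query an arbitrary edge $(u,v)$; set $v_0$ to the earlier of $u,v$ and $S$ to the set containing the later one; while there exists an edge $(u,v_0)\in E$ with $u\notin S$, query it, and if $u\prec v_0$ then add $v_0$ to $S$ and set $v_0\leftarrow u$, otherwise add $u$ to $S$; when no such edge exists, output $v_0$. This procedure always outputs $x_1$, and it deterministically uses at most $n$ queries. -}

module Defs where

open import Data.Nat using (ℕ; zero; suc)
open import Data.Fin using (Fin; inject₁) renaming (zero to fzero; suc to fsuc; _<_ to _<ᶠ_)
open import Data.Fin.Subset using (Subset; _∈_; _∉_; _∪_; ⁅_⁆)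
open import Data.Fin.Permutation using (Permutation′; _⟨$⟩ʳ_; _⟨$⟩ˡ_)
open import Data.Product using (_×_; _,_; proj₁)
open import Relation.Nullary using (¬_)

record Graph (n : ℕ) : Set₁ where
  field
    Edge   : Fin n → Fin n → Set
    sym    : ∀ {u v} → Edge u v → Edge v u
    irrefl : ∀ {u} → ¬ Edge u u
open Graph public

-- The true (hidden) total order on the vertices is given by a permutation π:
-- x_i = π ⟨$⟩ʳ i  (i is 0-based), and the rank of vertex v is π ⟨$⟩ˡ v.
-- u ≺ v  iff  u precedes v in the true order.
_≺[_]_ : ∀ {n} → Fin n → Permutation′ n → Fin n → Set
u ≺[ π ] v = (π ⟨$⟩ˡ u) <ᶠ (π ⟨$⟩ˡ v)

HamiltonianOrder : ∀ {m} → Graph (suc m) → Permutation′ (suc m) → Set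
HamiltonianOrder {m} G π = ∀ (i : Fin m) → Edge G (π ⟨$⟩ʳ inject₁ i) (π ⟨$⟩ʳ fsuc i)

first : ∀ {m} → Permutation′ (suc m) → Fin (suc m)
first π = π ⟨$⟩ʳ fzero

State : ℕ → Set
State n = Fin n × Subset n

output : ∀ {n} → State n → Fin n
output = proj₁

module Procedure {n : ℕ} (G : Graph n) (π : Permutation′ n) where

  -- State after the first query of an arbitrary edge (u , v):
  -- v₀ = the earlier endpoint, S = { the later endpoint }.
  -- (E is symmetric, so listing the edge with its earlier endpoint first covers all cases.)
  data Init : State n → Set where
    init : ∀ {u v} → Edge G u v → u ≺[ π ] v → Init (u , ⁅ v ⁆)

  data Step : State n → State n → Set where
    back : ∀ {v₀ S u} → Edge G u v₀ → u ∉ S → u ≺[ π ] v₀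
         → Step (v₀ , S) (u , S ∪ ⁅ v₀ ⁆)
    fwd  : ∀ {v₀ S u} → Edge G u v₀ → u ∉ S → ¬ (u ≺[ π ] v₀)
         → Step (v₀ , S) (v₀ , S ∪ ⁅ u ⁆)

  data Steps : ℕ → State n → State n → Set where
    done : ∀ {s} → Steps zero s s
    more : ∀ {k s t r} → Step s t → Steps k t r → Steps (suc k) s r

  Terminal : State n → Set
  Terminal (v₀ , S) = ∀ u → Edge G u v₀ → u ∈ S

-- Correctness: no vertex of S ever precedes the candidate v₀ (a vertex enters S only when it
-- is later than the candidate, and the candidate only moves backwards).  When the loop stops,
-- every neighbour of v₀ is in S, so v₀ has no earlier neighbour; on a Hamiltonian order only
-- x₁ has that property.  Termination bound: every query adds a new vertex to the set S ∪ {v₀}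
-- of touched vertices, which starts with two elements and never exceeds n.
module Submission where

open import Defs hiding (sym)
open import Data.Nat using (ℕ; suc; _≤_; _+_)
open import Data.Nat.Properties using (n≤1+n; +-comm; +-suc; +-monoʳ-≤; ≤-refl; ≤-trans; ≤-reflexive; module ≤-Reasoning)
open import Data.Product using (_×_; _,_; ∃-syntax)
open import Data.Sum using (_⊎_; inj₁; inj₂)
open import Data.Fin using (Fin; inject₁) renaming (zero to fzero; suc to fsuc)
open import Data.Fin.Properties using (≤̄⇒inject₁<; <-trans; <-asym) renaming (≤-refl to ≤ᶠ-refl)
open import Data.Fin.Subset using (Subset; _∈_; _∉_; _∪_; ⁅_⁆; ∣_∣; _⊂_)
open import Data.Fin.Subset.Properties using (x∈p∪q⁺; x∈p∪q⁻; x∈⁅x⁆; x∈⁅y⁆⇒x≡y; x≢y⇒x∉⁅y⁆; p⊆p∪q; p⊂q⇒∣p∣<∣q∣; ∣p∣≤n; ∣⁅x⁆∣≡1; ∪-assoc; ∪-comm)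
open import Data.Fin.Permutation using (Permutation′; _⟨$⟩ʳ_; _⟨$⟩ˡ_; inverseʳ; inverseˡ)
open import Relation.Binary.PropositionalEquality using (_≡_; _≢_; refl; sym; trans; cong; subst; module ≡-Reasoning)
open import Relation.Nullary using (¬_; contradiction)

x∉p∪⁅y⁆ : ∀ {n} {p : Subset n} {x y} → x ∉ p → x ≢ y → x ∉ p ∪ ⁅ y ⁆
x∉p∪⁅y⁆ {p = p} x∉p x≢y x∈ with x∈p∪q⁻ p _ x∈
... | inj₁ x∈p  = x∉p x∈p
... | inj₂ x∈⁅y⁆ = x≢y⇒x∉⁅y⁆ x≢y x∈⁅y⁆

p⊂p∪⁅x⁆ : ∀ {n} {p : Subset n} {x} → x ∉ p → p ⊂ p ∪ ⁅ x ⁆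
p⊂p∪⁅x⁆ {x = x} x∉p = p⊆p∪q _ , x , x∈p∪q⁺ (inj₂ (x∈⁅x⁆ x)) , x∉p

∪-swapʳ : ∀ {n} (p q r : Subset n) → (p ∪ q) ∪ r ≡ (p ∪ r) ∪ q
∪-swapʳ p q r = begin
  (p ∪ q) ∪ r  ≡⟨ ∪-assoc p q r ⟩
  p ∪ (q ∪ r)  ≡⟨ cong (p ∪_) (∪-comm q r) ⟩
  p ∪ (r ∪ q)  ≡⟨ sym (∪-assoc p r q) ⟩
  (p ∪ r) ∪ q  ∎
  where open ≡-Reasoning

Edge⇒≢ : ∀ {n} (G : Graph n) {u v} → Edge G u v → u ≢ v
Edge⇒≢ G e refl = irrefl G e

⟨$⟩ˡ≡⇒≡⟨$⟩ʳ : ∀ {n} (π : Permutation′ n) {v r} → π ⟨$⟩ˡ v ≡ r → v ≡ π ⟨$⟩ʳ r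
⟨$⟩ˡ≡⇒≡⟨$⟩ʳ π rank = trans (sym (inverseʳ π)) (cong (π ⟨$⟩ʳ_) rank)

module _ {m : ℕ} (π : Permutation′ (suc m)) where

  consecutive-≺ : ∀ (i : Fin m) → (π ⟨$⟩ʳ inject₁ i) ≺[ π ] (π ⟨$⟩ʳ fsuc i)
  consecutive-≺ i rewrite inverseˡ π {inject₁ i} | inverseˡ π {fsuc i} = ≤̄⇒inject₁< ≤ᶠ-refl

  first-or-successor : ∀ v → v ≡ first π ⊎ ∃[ i ] v ≡ π ⟨$⟩ʳ fsuc i
  first-or-successor v with π ⟨$⟩ˡ v in rank
  ... | fzero  = inj₁ (⟨$⟩ˡ≡⇒≡⟨$⟩ʳ π rank)
  ... | fsuc i = inj₂ (i , ⟨$⟩ˡ≡⇒≡⟨$⟩ʳ π rank)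

  no-earlier-neighbour⇒first : (G : Graph (suc m)) → HamiltonianOrder G π → ∀ {v}
    → (∀ u → Edge G u v → ¬ u ≺[ π ] v) → v ≡ first π
  no-earlier-neighbour⇒first G ham {v} minimal with first-or-successor v
  ... | inj₁ v≡x₁       = v≡x₁
  ... | inj₂ (i , refl) = contradiction (consecutive-≺ i) (minimal _ (ham i))

touched : ∀ {n} → State n → Subset n
touched (v₀ , S) = S ∪ ⁅ v₀ ⁆

module _ {n : ℕ} (G : Graph n) (π : Permutation′ n) where
  open Procedure G π

  NothingInSPrecedes : State n → Set
  NothingInSPrecedes (v₀ , S) = ∀ w → w ∈ S → ¬ w ≺[ π ] v₀

  init-NothingInSPrecedes : ∀ {s} → Init s → NothingInSPrecedes s
  init-NothingInSPrecedes (init _ u≺v) w w∈⁅v⁆ rewrite x∈⁅y⁆⇒x≡y _ w∈⁅v⁆ = <-asym u≺v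

  step-NothingInSPrecedes : ∀ {s t} → Step s t → NothingInSPrecedes s → NothingInSPrecedes t
  step-NothingInSPrecedes {_ , S} (back _ _ u≺v₀) inv w w∈ w≺u with x∈p∪q⁻ S _ w∈
  ... | inj₁ w∈S    = inv w w∈S (<-trans w≺u u≺v₀)
  ... | inj₂ w∈⁅v₀⁆ rewrite x∈⁅y⁆⇒x≡y _ w∈⁅v₀⁆ = <-asym w≺u u≺v₀
  step-NothingInSPrecedes {_ , S} (fwd _ _ u⊀v₀) inv w w∈ with x∈p∪q⁻ S _ w∈
  ... | inj₁ w∈S   = inv w w∈S
  ... | inj₂ w∈⁅u⁆ rewrite x∈⁅y⁆⇒x≡y _ w∈⁅u⁆ = u⊀v₀

  steps-NothingInSPrecedes : ∀ {k s t} → Steps k s t → NothingInSPrecedes s → NothingInSPrecedes t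
  steps-NothingInSPrecedes done             inv = inv
  steps-NothingInSPrecedes (more step rest) inv =
    steps-NothingInSPrecedes rest (step-NothingInSPrecedes step inv)

  terminal⇒no-earlier-neighbour : ∀ {t} → NothingInSPrecedes t → Terminal t
    → ∀ u → Edge G u (output t) → ¬ u ≺[ π ] output t
  terminal⇒no-earlier-neighbour inv terminal u e = inv u (terminal u e)

  init-touched : ∀ {s} → Init s → 2 ≤ ∣ touched s ∣
  init-touched (init {u} {v} e _) =
    subst (λ k → suc k ≤ ∣ touched (u , ⁅ v ⁆) ∣) (∣⁅x⁆∣≡1 v)
      (p⊂q⇒∣p∣<∣q∣ (p⊂p∪⁅x⁆ (x≢y⇒x∉⁅y⁆ (Edge⇒≢ G e))))

  step-touched : ∀ {s t} → Step s t → touched s ⊂ touched t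
  step-touched (back e u∉S _) = p⊂p∪⁅x⁆ (x∉p∪⁅y⁆ u∉S (Edge⇒≢ G e))
  step-touched {_ , S} (fwd {v₀ = v₀} {u = u} e u∉S _) =
    subst (touched (v₀ , S) ⊂_) (∪-swapʳ S ⁅ v₀ ⁆ ⁅ u ⁆)
      (p⊂p∪⁅x⁆ (x∉p∪⁅y⁆ u∉S (Edge⇒≢ G e)))

  steps-touched : ∀ {k s t} → Steps k s t → k + ∣ touched s ∣ ≤ ∣ touched t ∣
  steps-touched done             = ≤-refl
  steps-touched (more step rest) = ≤-trans
    (≤-reflexive (sym (+-suc _ _)))
    (≤-trans (+-monoʳ-≤ _ (p⊂q⇒∣p∣<∣q∣ (step-touched step))) (steps-touched rest))

proposition2 : ∀ {m} (G : Graph (suc (suc m))) (π : Permutation′ (suc (suc m)))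
    → HamiltonianOrder G π
    → let open Procedure G π in
    (∀ {s t} k → Init s → Steps k s t → Terminal t → output t ≡ first π) × (∀ {s t} k → Init s → Steps k s t → suc k ≤ suc (suc m))
proposition2 {m} G π ham = correct , bound
  where
  open Procedure G π

  correct : ∀ {s t} k → Init s → Steps k s t → Terminal t → output t ≡ first π
  correct _ initial run terminal = no-earlier-neighbour⇒first π G ham
    (terminal⇒no-earlier-neighbour G π
      (steps-NothingInSPrecedes G π run (init-NothingInSPrecedes G π initial)) terminal)

  bound : ∀ {s t} k → Init s → Steps k s t → suc k ≤ suc (suc m)
  bound {s} {t} k initial run = begin
    suc k              ≤⟨ n≤1+n (suc k) ⟩
    2 + k              ≡⟨ +-comm 2 k ⟩
    k + 2              ≤⟨ +-monoʳ-≤ k (init-touched G π initial) ⟩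
    k + ∣ touched s ∣  ≤⟨ steps-touched G π run ⟩
    ∣ touched t ∣      ≤⟨ ∣p∣≤n (touched t) ⟩
    suc (suc m)        ∎
    where open ≤-Reasoning
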